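{- Let $C$ be a subclone of $P(\mathbb{Z}_8,+,\cdot)$ containing the binary addition and all unary constant operations. Let $f\in C$ be an $n$-ary operation given by a polynomial $\sum_\alpha a_\alpha x_1^{\alpha_1}\cdots x_n^{\alpha_n}$, and let $g$ be the operation given by the sum of those monomials of this polynomial that contain all the variables $x_1,\dots,x_n$. Then $g\in C$.
   Context: $P(\mathbb{Z}_8,+,\cdot)$ is the clone of all polynomial operations of the ring $\mathbb{Z}_8$, i.e. operations given by polynomials with coefficients in $\mathbb{Z}_8$. -}

module Defs where

open import Data.Nat as ℕ using (ℕ; zero; suc)
open import Data.Nat.DivMod using (_mod_)
open import Data.Fin using (Fin; toℕ; zero; suc)
open import Data.Bool using (Bool; true; false; _∧_)
open import Data.List using (List; []; _∷_; filter)
open import Data.Product using (_×_; _,_; Σ; ∃)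
open import Relation.Binary.PropositionalEquality using (_≡_)
open import Relation.Nullary.Decidable using (yes; no)
open import Data.Bool.Properties using (T?)
open import Data.Bool using (T)

Z8 : Set
Z8 = Fin 8

infixl 6 _+₈_
infixl 7 _*₈_

_+₈_ : Z8 → Z8 → Z8
a +₈ b = (toℕ a ℕ.+ toℕ b) mod 8

_*₈_ : Z8 → Z8 → Z8
a *₈ b = (toℕ a ℕ.* toℕ b) mod 8

one₈ : Z8
one₈ = suc zero

_^₈_ : Z8 → ℕ → Z8
a ^₈ zero = one₈
a ^₈ suc k = a *₈ (a ^₈ k)

Op : ℕ → Set
Op n = (Fin n → Z8) → Z8

prod : (n : ℕ) → (Fin n → Z8) → Z8
prod zero    v = one₈
prod (suc n) v = v zero *₈ prod n (λ i → v (suc i))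

Monomial : ℕ → Set
Monomial n = Z8 × (Fin n → ℕ)

Poly : ℕ → Set
Poly n = List (Monomial n)

evalMono : {n : ℕ} → Monomial n → Op n
evalMono {n} (a , α) x = a *₈ prod n (λ i → x i ^₈ α i)

evalPoly : {n : ℕ} → Poly n → Op n
evalPoly []       x = zero
evalPoly (m ∷ ms) x = evalMono m x +₈ evalPoly ms x

allPos : (n : ℕ) → (Fin n → ℕ) → Bool
allPos zero    α = true
allPos (suc n) α with α zero
... | zero  = false
... | suc _ = allPos n (λ i → α (suc i))

containsAllVars : {n : ℕ} → Monomial n → Bool
containsAllVars {n} (a , α) = allPos n α

fullPart : {n : ℕ} → Poly n → Poly n
fullPart = filter (λ m → T? (containsAllVars m))

OpSet : Set₁
OpSet = (n : ℕ) → Op n → Set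

-- Clone: contains projections, closed under composition; as a set of
-- functions it is closed under (pointwise) equality of functions.
record IsClone (C : OpSet) : Set where
  field
    ext  : ∀ n (f g : Op n) → (∀ x → f x ≡ g x) → C n f → C n g
    proj : ∀ n (i : Fin n) → C n (λ x → x i)
    comp : ∀ n m (f : Op m) (gs : Fin m → Op n) →
           C m f → (∀ j → C n (gs j)) → C n (λ x → f (λ j → gs j x))

IsPolyOp : {n : ℕ} → Op n → Set
IsPolyOp {n} f = Σ (Poly n) λ P → ∀ x → f x ≡ evalPoly P x

SubcloneOfPolys : OpSet → Set
SubcloneOfPolys C = ∀ n (f : Op n) → C n f → IsPolyOp f

ContainsAddition : OpSet → Set
ContainsAddition C = C 2 (λ x → x zero +₈ x (suc zero))

ContainsConstants : OpSet → Set
ContainsConstants C = ∀ (c : Z8) → C 1 (λ _ → c)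

{-# OPTIONS --safe #-}
-- Let Δᵢ h (x) = h (x) − h (x with xᵢ := 0). Subtraction is available in C as a
-- sum of copies of +, and setting xᵢ := 0 is composition with constants and
-- projections, so C is closed under every Δᵢ. Applied to a polynomial, Δᵢ cancels
-- the monomials not involving xᵢ and keeps the others, which vanish at xᵢ = 0.
-- Hence Δ₁ ⋯ Δₙ f is the sum of the monomials involving all variables.
module Submission where

open import Defs
open import Data.Nat using (ℕ; zero; suc; NonZero)
open import Data.Nat.Properties using (nonZero?)
open import Data.Fin using (Fin; zero; suc; _≟_)
open import Data.Fin.Properties using (all?)
open import Data.Vec.Functional using (updateAt)
open import Data.Vec.Functional.Properties using (updateAt-updates; updateAt-minimal)
open import Data.List using (List; []; _∷_; filter)
open import Data.List.Properties using (filter-accept; filter-reject; filter-all; filter-≐)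
open import Data.List.Relation.Unary.All using (universal)
open import Data.Product using (_,_; proj₁; proj₂)
open import Data.Bool using (T)
open import Data.Bool.Properties using (T?)
open import Data.Unit using (tt)
open import Function using (_∘_; const; id)
open import Relation.Binary.PropositionalEquality using (_≡_; refl; sym; trans; cong; cong₂; module ≡-Reasoning)
open import Relation.Nullary using (Dec; yes; no; ¬_; contradiction)
open import Relation.Nullary.Decidable using (toWitness)
open import Relation.Unary using (Pred; Decidable; _∩_; _≐_)
open import Relation.Unary.Properties using (_∩?_)

filter-filter : ∀ {a p q} {A : Set a} {P : Pred A p} {Q : Pred A q}
                (P? : Decidable P) (Q? : Decidable Q) (xs : List A) →
                filter P? (filter Q? xs) ≡ filter (P? ∩? Q?) xs
filter-filter P? Q? [] = refl
filter-filter P? Q? (x ∷ xs) with Q? x | P? x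
... | yes _ | yes p  = trans (filter-accept P? p) (cong (x ∷_) (filter-filter P? Q? xs))
... | yes _ | no ¬p  = trans (filter-reject P? ¬p) (filter-filter P? Q? xs)
... | no _  | yes _  = filter-filter P? Q? xs
... | no _  | no _   = filter-filter P? Q? xs

infixl 7 _×₈_
infixl 6 _-₈_

_×₈_ : ℕ → Z8 → Z8
zero  ×₈ y = zero
suc k ×₈ y = y +₈ k ×₈ y

-- Since 7 ≡ -1 (mod 8), subtraction is built from addition alone.
_-₈_ : Z8 → Z8 → Z8
a -₈ b = a +₈ 7 ×₈ b

*₈-zeroʳ : ∀ a → a *₈ zero ≡ zero
*₈-zeroʳ = toWitness {a? = all? λ a → a *₈ zero ≟ zero} tt

[a+b]-[a+c]≡b-c : ∀ a b c → (a +₈ b) -₈ (a +₈ c) ≡ b -₈ c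
[a+b]-[a+c]≡b-c = toWitness
  {a? = all? λ a → all? λ b → all? λ c → (a +₈ b) -₈ (a +₈ c) ≟ b -₈ c} tt

[a+b]-[0+c]≡a+[b-c] : ∀ a b c → (a +₈ b) -₈ (zero +₈ c) ≡ a +₈ (b -₈ c)
[a+b]-[0+c]≡a+[b-c] = toWitness
  {a? = all? λ a → all? λ b → all? λ c → (a +₈ b) -₈ (zero +₈ c) ≟ a +₈ (b -₈ c)} tt

prod-cong : ∀ n {v w : Fin n → Z8} → (∀ j → v j ≡ w j) → prod n v ≡ prod n w
prod-cong zero    v≗w = refl
prod-cong (suc n) v≗w = cong₂ _*₈_ (v≗w zero) (prod-cong n (v≗w ∘ suc))

prod-zero : ∀ n (v : Fin n → Z8) i → v i ≡ zero → prod n v ≡ zero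
prod-zero (suc n) v zero    vi≡0 rewrite vi≡0 = refl
prod-zero (suc n) v (suc i) vi≡0 rewrite prod-zero n (v ∘ suc) i vi≡0 = *₈-zeroʳ (v zero)

_[_]≔0 : ∀ {n} → (Fin n → Z8) → Fin n → Fin n → Z8
x [ i ]≔0 = updateAt x i (const zero)

¬NonZero⇒≡0 : ∀ {k} → ¬ NonZero k → k ≡ 0
¬NonZero⇒≡0 {zero}  _   = refl
¬NonZero⇒≡0 {suc k} ¬nz = contradiction _ ¬nz

0^₈k≡0 : ∀ k → .{{NonZero k}} → zero ^₈ k ≡ zero
0^₈k≡0 (suc k) = refl

evalMono-updateAt : ∀ {n} a (α : Fin n → ℕ) i x f → ¬ NonZero (α i) →
                    evalMono (a , α) (updateAt x i f) ≡ evalMono (a , α) x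
evalMono-updateAt {n} a α i x f αi≯0 = cong (a *₈_) (prod-cong n factor)
  where
  factor : ∀ j → updateAt x i f j ^₈ α j ≡ x j ^₈ α j
  factor j with j ≟ i
  ... | yes refl rewrite ¬NonZero⇒≡0 αi≯0 = refl
  ... | no j≢i = cong (_^₈ α j) (updateAt-minimal j i x j≢i)

evalMono-[]≔0 : ∀ {n} a (α : Fin n → ℕ) i x → NonZero (α i) →
                evalMono (a , α) (x [ i ]≔0) ≡ zero
evalMono-[]≔0 {n} a α i x αi≢0 =
  trans (cong (a *₈_) (prod-zero n _ i factor)) (*₈-zeroʳ a)
  where
  factor : (x [ i ]≔0) i ^₈ α i ≡ zero
  factor rewrite updateAt-updates i {const zero} x = 0^₈k≡0 (α i) {{αi≢0}}

Δ : ∀ {n} → Fin n → Op n → Op n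
Δ i h x = h x -₈ h (x [ i ]≔0)

HasVar : ∀ {n} → Fin n → Pred (Monomial n) _
HasVar i (a , α) = NonZero (α i)

hasVar? : ∀ {n} (i : Fin n) → Decidable (HasVar i)
hasVar? i (a , α) = nonZero? (α i)

module _ {n} (i : Fin n) (m : Monomial n) (P : Poly n) (x : Fin n → Z8) where
  open ≡-Reasoning

  Δ-∷-absent : ¬ HasVar i m → Δ i (evalPoly (m ∷ P)) x ≡ Δ i (evalPoly P) x
  Δ-∷-absent ¬m∋xᵢ = begin
    (evalMono m x +₈ evalPoly P x) -₈ (evalMono m (x [ i ]≔0) +₈ evalPoly P (x [ i ]≔0))
      ≡⟨ cong (λ y → (evalMono m x +₈ evalPoly P x) -₈ (y +₈ evalPoly P (x [ i ]≔0)))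
              (evalMono-updateAt (proj₁ m) (proj₂ m) i x (const zero) ¬m∋xᵢ) ⟩
    (evalMono m x +₈ evalPoly P x) -₈ (evalMono m x +₈ evalPoly P (x [ i ]≔0))
      ≡⟨ [a+b]-[a+c]≡b-c (evalMono m x) (evalPoly P x) (evalPoly P (x [ i ]≔0)) ⟩
    Δ i (evalPoly P) x ∎

  Δ-∷-present : HasVar i m → Δ i (evalPoly (m ∷ P)) x ≡ evalMono m x +₈ Δ i (evalPoly P) x
  Δ-∷-present m∋xᵢ = begin
    (evalMono m x +₈ evalPoly P x) -₈ (evalMono m (x [ i ]≔0) +₈ evalPoly P (x [ i ]≔0))
      ≡⟨ cong (λ y → (evalMono m x +₈ evalPoly P x) -₈ (y +₈ evalPoly P (x [ i ]≔0)))
              (evalMono-[]≔0 (proj₁ m) (proj₂ m) i x m∋xᵢ) ⟩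
    (evalMono m x +₈ evalPoly P x) -₈ (zero +₈ evalPoly P (x [ i ]≔0))
      ≡⟨ [a+b]-[0+c]≡a+[b-c] (evalMono m x) (evalPoly P x) (evalPoly P (x [ i ]≔0)) ⟩
    evalMono m x +₈ Δ i (evalPoly P) x ∎

Δ-evalPoly : ∀ {n} (i : Fin n) P x → Δ i (evalPoly P) x ≡ evalPoly (filter (hasVar? i) P) x
Δ-evalPoly i []      x = refl
Δ-evalPoly i (m ∷ P) x = by-cases (hasVar? i m)
  where
  open ≡-Reasoning
  by-cases : Dec (HasVar i m) → Δ i (evalPoly (m ∷ P)) x ≡ evalPoly (filter (hasVar? i) (m ∷ P)) x
  by-cases (yes m∋xᵢ) = begin
    Δ i (evalPoly (m ∷ P)) x                   ≡⟨ Δ-∷-present i m P x m∋xᵢ ⟩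
    evalMono m x +₈ Δ i (evalPoly P) x         ≡⟨ cong (evalMono m x +₈_) (Δ-evalPoly i P x) ⟩
    evalPoly (m ∷ filter (hasVar? i) P) x
      ≡⟨ cong (λ Q → evalPoly Q x) (filter-accept (hasVar? i) {m} {P} m∋xᵢ) ⟨
    evalPoly (filter (hasVar? i) (m ∷ P)) x    ∎
  by-cases (no m∌xᵢ) = begin
    Δ i (evalPoly (m ∷ P)) x                   ≡⟨ Δ-∷-absent i m P x m∌xᵢ ⟩
    Δ i (evalPoly P) x                         ≡⟨ Δ-evalPoly i P x ⟩
    evalPoly (filter (hasVar? i) P) x
      ≡⟨ cong (λ Q → evalPoly Q x) (filter-reject (hasVar? i) {m} {P} m∌xᵢ) ⟨
    evalPoly (filter (hasVar? i) (m ∷ P)) x    ∎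

ΔAlong : ∀ {k n} → (Fin k → Fin n) → Op n → Op n
ΔAlong {zero}  σ h = h
ΔAlong {suc k} σ h = Δ (σ zero) (ΔAlong (σ ∘ suc) h)

HasVars : ∀ {k n} → (Fin k → Fin n) → Pred (Monomial n) _
HasVars {k} σ (a , α) = T (allPos k (α ∘ σ))

hasVars? : ∀ {k n} (σ : Fin k → Fin n) → Decidable (HasVars σ)
hasVars? {k} σ (a , α) = T? (allPos k (α ∘ σ))

hasVars-suc : ∀ {k n} (σ : Fin (suc k) → Fin n) → HasVar (σ zero) ∩ HasVars (σ ∘ suc) ≐ HasVars σ
hasVars-suc σ = (λ {m} → to m) , (λ {m} → from m)
  where
  to : ∀ m → (HasVar (σ zero) ∩ HasVars (σ ∘ suc)) m → HasVars σ m
  to (a , α) (_ , h) with α (σ zero)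
  ... | suc _ = h
  from : ∀ m → HasVars σ m → (HasVar (σ zero) ∩ HasVars (σ ∘ suc)) m
  from (a , α) h with α (σ zero)
  ... | suc _ = _ , h

ΔAlong-evalPoly : ∀ {k n} (σ : Fin k → Fin n) P x →
                  ΔAlong σ (evalPoly P) x ≡ evalPoly (filter (hasVars? σ) P) x
ΔAlong-evalPoly {zero}  σ P x =
  cong (λ Q → evalPoly Q x) (sym (filter-all (hasVars? σ) (universal (λ _ → tt) P)))
ΔAlong-evalPoly {suc k} σ P x = begin
  Δ (σ zero) (ΔAlong (σ ∘ suc) (evalPoly P)) x
    ≡⟨ cong₂ _-₈_ (ΔAlong-evalPoly (σ ∘ suc) P x) (ΔAlong-evalPoly (σ ∘ suc) P (x [ σ zero ]≔0)) ⟩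
  Δ (σ zero) (evalPoly (filter (hasVars? (σ ∘ suc)) P)) x
    ≡⟨ Δ-evalPoly (σ zero) (filter (hasVars? (σ ∘ suc)) P) x ⟩
  evalPoly (filter (hasVar? (σ zero)) (filter (hasVars? (σ ∘ suc)) P)) x
    ≡⟨ cong (λ Q → evalPoly Q x) (filter-filter _ _ P) ⟩
  evalPoly (filter (hasVar? (σ zero) ∩? hasVars? (σ ∘ suc)) P) x
    ≡⟨ cong (λ Q → evalPoly Q x) (filter-≐ _ _ (hasVars-suc σ) P) ⟩
  evalPoly (filter (hasVars? σ) P) x ∎
  where open ≡-Reasoning

module ClosureProperties {C : OpSet} (isClone : IsClone C)
                         (addition : ContainsAddition C) (constants : ContainsConstants C) where
  open IsClone isClone

  -- C has no nullary projections, so C 0 may be empty: constants of arity n need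
  -- some member of C n to be composed with.
  const-closed : ∀ {n} {h : Op n} → C n h → (c : Z8) → C n (λ _ → c)
  const-closed {n} Ch c = comp n 1 (λ _ → c) (λ _ → _) (constants c) (λ _ → Ch)

  +₈-closed : ∀ {n} {g h : Op n} → C n g → C n h → C n (λ x → g x +₈ h x)
  +₈-closed {n} {g} {h} Cg Ch = comp n 2 _ summands addition closed
    where
    summands : Fin 2 → Op n
    summands zero       = g
    summands (suc zero) = h
    closed : ∀ j → C n (summands j)
    closed zero       = Cg
    closed (suc zero) = Ch

  ×₈-closed : ∀ {n} {h : Op n} k → C n h → C n (λ x → k ×₈ h x)
  ×₈-closed zero    Ch = const-closed Ch zero
  ×₈-closed (suc k) Ch = +₈-closed Ch (×₈-closed k Ch)

  -₈-closed : ∀ {n} {g h : Op n} → C n g → C n h → C n (λ x → g x -₈ h x)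
  -₈-closed Cg Ch = +₈-closed Cg (×₈-closed 7 Ch)

  []≔0-closed : ∀ {n} {h : Op n} (i : Fin n) → C n h → C n (λ x → h (x [ i ]≔0))
  []≔0-closed {n} {h} i Ch = comp n n h (λ j x → (x [ i ]≔0) j) Ch coordinate
    where
    coordinate : ∀ j → C n (λ x → (x [ i ]≔0) j)
    coordinate j with j ≟ i
    ... | yes refl = ext n _ _ (λ x → sym (updateAt-updates i x)) (const-closed Ch zero)
    ... | no j≢i   = ext n _ _ (λ x → sym (updateAt-minimal j i x j≢i)) (proj n j)

  Δ-closed : ∀ {n} {h : Op n} (i : Fin n) → C n h → C n (Δ i h)
  Δ-closed i Ch = -₈-closed Ch ([]≔0-closed i Ch)

  ΔAlong-closed : ∀ {k n} {h : Op n} (σ : Fin k → Fin n) → C n h → C n (ΔAlong σ h)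
  ΔAlong-closed {zero}  σ Ch = Ch
  ΔAlong-closed {suc k} σ Ch = Δ-closed (σ zero) (ΔAlong-closed (σ ∘ suc) Ch)

lemma3p2 : (C : OpSet) → IsClone C → SubcloneOfPolys C →
           ContainsAddition C → ContainsConstants C →
           (n : ℕ) (P : Poly n) (f : Op n) → C n f →
           (∀ x → f x ≡ evalPoly P x) →
           C n (evalPoly (fullPart P))
lemma3p2 C isClone _ addition constants n P f Cf f≗P =
  ext n (ΔAlong id (evalPoly P)) (evalPoly (fullPart P)) (ΔAlong-evalPoly id P)
      (ΔAlong-closed id (ext n f (evalPoly P) f≗P Cf))
  where
  open IsClone isClone
  open ClosureProperties isClone addition constants
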